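{- Let $U=(X,B)$ be an abstract unital of order $n\ge 3$. (i) If $U$ has an embedded dual $k$-net $\{b_1,\dots,b_k\}$, then $k\le n-1$. (ii) For two distinct blocks $b_1,b_2$, the set $F_U(b_1,b_2)$ cannot contain (as subsets) more than $n-3$ distinct blocks.
   Context: An abstract unital of order $n$ is a $2$-$(n^3+1,n+1,1)$ design $(X,B)$. For blocks $b_1,b_2$, a point $P\in X$ is a full point with respect to $(b_1,b_2)$ if $P\notin b_1\cup b_2$ and for every $Q\in b_1$ the block through $P$ and $Q$ intersects $b_2$; $F_U(b_1,b_2)$ is the set of such points. For an integer $k\ge3$, blocks $b_1,\dots,b_k$ form an embedded dual $k$-net in $U$ if for all $1\le i<j\le k$: $b_i\cap b_j=\emptyset$, and for all $P\in b_i$, $Q\in b_j$ the block containing $P$ and $Q$ intersects each of $b_1,\dots,b_k$ in a point. -}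

module Defs where

open import Data.Nat using (ℕ; suc; _+_; _^_; _≤_; _∸_)
open import Data.Fin using (Fin)
open import Data.Fin.Subset using (Subset; _∈_; _∉_; ∣_∣)
open import Data.Product using (Σ; ∃; ∃-syntax; _×_; _,_)
open import Relation.Binary.PropositionalEquality using (_≡_; _≢_)
open import Relation.Nullary using (¬_)
open import Function.Definitions using (Injective)

record Unital (n : ℕ) : Set where
  field
    numBlocks : ℕ
    block     : Fin numBlocks → Subset (n ^ 3 + 1)
    blockSize : ∀ b → ∣ block b ∣ ≡ n + 1
    twoPoints : ∀ (P Q : Fin (n ^ 3 + 1)) → P ≢ Q →
                ∃[ b ] ((P ∈ block b × Q ∈ block b) ×
                        (∀ b' → P ∈ block b' → Q ∈ block b' → b' ≡ b))

module _ {n : ℕ} (U : Unital n) where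
  open Unital U

  Point : Set
  Point = Fin (n ^ 3 + 1)

  Block : Set
  Block = Fin numBlocks

  _∈ᵇ_ : Point → Block → Set
  P ∈ᵇ b = P ∈ block b

  Meets : Block → Block → Set
  Meets b c = ∃[ R ] (R ∈ᵇ b × R ∈ᵇ c)

  Disjoint : Block → Block → Set
  Disjoint b c = ∀ R → R ∈ᵇ b → ¬ (R ∈ᵇ c)

  -- "the block through P and Q intersects c": every block containing
  -- both P and Q meets c (such a block is unique when P ≠ Q).
  JoinMeets : Point → Point → Block → Set
  JoinMeets P Q c = ∀ d → P ∈ᵇ d → Q ∈ᵇ d → Meets d c

  IsFullPoint : Block → Block → Point → Set
  IsFullPoint b₁ b₂ P =
    ¬ (P ∈ᵇ b₁) × ¬ (P ∈ᵇ b₂) × (∀ Q → Q ∈ᵇ b₁ → JoinMeets P Q b₂)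

  IsEmbeddedDualNet : (k : ℕ) → (Fin k → Block) → Set
  IsEmbeddedDualNet k bs =
    3 ≤ k ×
    (∀ i j → i ≢ j →
       Disjoint (bs i) (bs j) ×
       (∀ P Q → P ∈ᵇ bs i → Q ∈ᵇ bs j → ∀ l → JoinMeets P Q (bs l)))

  BlockInFullPoints : Block → Block → Block → Set
  BlockInFullPoints b₁ b₂ c = ∀ P → P ∈ᵇ c → IsFullPoint b₁ b₂ P

-- (i) It suffices to refute an embedded dual net of exactly n blocks bₗ. A block through points
-- of two of them meets all of them (a net line); having n + 1 points, one on each bₗ, it carries
-- at most one point outside the net, and it is determined by its points on b₀ and b₁, so there
-- are at most (n + 1)² net lines. Every outside point P lies on two net lines: otherwise some
-- Xₗ ∈ bₗ is the only point of bₗ on a net line through P, the n² blocks joining P to the other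
-- points of the bₗ are pairwise distinct, and together with P and X₀ they carry n³ + 2 points.
-- Labelling every point twice, by its place on a net block or by two net lines through it,
-- gives 2(n³ + 1) ≤ 2n(n + 1) + (n + 1)², which fails for n ≥ 3.
--
-- (ii) Central projection from a point P off blocks s and s', such that every block through P
-- and a point of s meets s', is a bijection from s onto s' as both have n + 1 points. Projecting
-- from full points and from points of b₁ shows that b₁, b₂ and any t ≥ 1 distinct blocks of
-- full points form an embedded dual (t + 2)-net, so t + 2 ≤ n - 1 by (i).

module Submission where

open import Defs
open import Data.Nat using (ℕ; _≤_; _∸_)
open import Data.Fin using (Fin)
open import Data.Product using (_×_)
open import Relation.Binary.PropositionalEquality using (_≢_)
open import Function.Definitions using (Injective)
open import Relation.Binary.PropositionalEquality using (_≡_)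

open import Data.Empty using (⊥; ⊥-elim)
open import Data.Fin using (zero; suc; punchIn; punchOut; inject≤)
open import Data.Fin.Properties
  using (_≟_; any?; all?; injective⇒≤; punchIn-injective; punchInᵢ≢i; punchOut-injective;
         inject≤-injective; +↔⊎; *↔×)
open import Data.Fin.Subset using (Subset; _∈_; _∉_; ∣_∣; inside; outside)
open import Data.Fin.Subset.Properties using (_∈?_)
open import Data.Nat using (zero; suc; _+_; _*_; _^_; _≰_; _≤?_; s≤s; z≤n; s≤s⁻¹)
import Data.Nat.Properties as ℕ
open import Data.Nat.Tactic.RingSolver using (solve-∀)
open import Data.Product using (Σ; ∃; ∃-syntax; _,_; proj₁; proj₂)
import Data.Product as Product
open import Data.Product.Function.NonDependent.Propositional using (_×-↔_)
open import Data.Product.Properties using (,-injectiveˡ; ,-injectiveʳ)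
open import Data.Sum using (_⊎_; inj₁; inj₂)
open import Data.Sum.Function.Propositional using (_⊎-↔_)
open import Data.Sum.Properties using (inj₁-injective; inj₂-injective)
open import Data.Vec.Base using (_∷_; here; there)
open import Data.Vec.Properties.WithK using ([]=-irrelevant)
open import Function using (_∘_)
open import Function.Bundles using (_↔_; Inverse; Injection; mk↔ₛ′)
open import Function.Properties.Inverse using (↔-refl; ↔-sym; ↔-trans; ↔⇒↣)
open import Relation.Binary.PropositionalEquality using (refl; sym; trans; cong; subst)
open import Relation.Nullary using (Dec; yes; no; contradiction)
open import Relation.Nullary.Decidable using (_×-dec_; ¬?; decidable-stable)

Members : ∀ {N} → Subset N → Set
Members {N} s = Σ (Fin N) (_∈ s)

member-≡ : ∀ {N} {s : Subset N} {x y : Fin N} {p : x ∈ s} {q : y ∈ s} →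
           x ≡ y → _≡_ {A = Members s} (x , p) (y , q)
member-≡ refl = cong (_ ,_) ([]=-irrelevant _ _)

rank : ∀ {N} (s : Subset N) → Members s → Fin ∣ s ∣
rank (inside  ∷ s) (zero  , here)    = zero
rank (inside  ∷ s) (suc x , there p) = suc (rank s (x , p))
rank (outside ∷ s) (suc x , there p) = rank s (x , p)

select : ∀ {N} (s : Subset N) → Fin ∣ s ∣ → Members s
select (inside  ∷ s) zero    = zero , here
select (inside  ∷ s) (suc i) = Product.map suc there (select s i)
select (outside ∷ s) i       = Product.map suc there (select s i)

rank-select : ∀ {N} (s : Subset N) i → rank s (select s i) ≡ i
rank-select (inside  ∷ s) zero    = refl
rank-select (inside  ∷ s) (suc i) = cong suc (rank-select s i)
rank-select (outside ∷ s) i       = rank-select s i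

select-rank : ∀ {N} (s : Subset N) x → select s (rank s x) ≡ x
select-rank (inside  ∷ s) (zero  , here)    = refl
select-rank (inside  ∷ s) (suc x , there p) = cong (Product.map suc there) (select-rank s (x , p))
select-rank (outside ∷ s) (suc x , there p) = cong (Product.map suc there) (select-rank s (x , p))

members↔ : ∀ {N} (s : Subset N) → Members s ↔ Fin ∣ s ∣
members↔ s = mk↔ₛ′ (rank s) (select s) (rank-select s) (select-rank s)

injective⇒surjective : ∀ {m n} {f : Fin m → Fin n} → n ≤ m → Injective _≡_ _≡_ f →
                       ∀ y → ∃ λ x → f x ≡ y
injective⇒surjective {n = suc n} {f} n≤m f-inj y with any? (λ x → f x ≟ y)
... | yes hit  = hit
... | no  miss = contradiction n≤m (ℕ.≤⇒≯ (injective⇒≤ punchOut-f-injective))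
  where
    avoids : ∀ x → y ≢ f x
    avoids x y≡fx = miss (x , sym y≡fx)
    punchOut-f-injective : Injective _≡_ _≡_ (λ x → punchOut (avoids x))
    punchOut-f-injective eq = f-inj (punchOut-injective (avoids _) (avoids _) eq)

module _ {A B : Set} {m n : ℕ} (A↔ : A ↔ Fin m) (B↔ : B ↔ Fin n) {f : A → B}
         (f-inj : Injective _≡_ _≡_ f) where
  private
    g : Fin m → Fin n
    g = Inverse.to B↔ ∘ f ∘ Inverse.from A↔
    g-injective : Injective _≡_ _≡_ g
    g-injective = Injection.injective (↔⇒↣ (↔-sym A↔)) ∘ f-inj ∘ Injection.injective (↔⇒↣ B↔)

  injective⇒card≤ : m ≤ n
  injective⇒card≤ = injective⇒≤ g-injective

  injective⇒onto : n ≤ m → ∀ y → ∃ λ x → f x ≡ y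
  injective⇒onto n≤m y with injective⇒surjective n≤m g-injective (Inverse.to B↔ y)
  ... | i , gi≡y = Inverse.from A↔ i , Injection.injective (↔⇒↣ B↔) gi≡y

module Geometry {n : ℕ} (U : Unital n) where
  open Unital U using (block; blockSize; twoPoints) public

  points↔ : (b : Block U) → Members (block b) ↔ Fin (suc n)
  points↔ b = subst (λ k → Members (block b) ↔ Fin k)
                    (trans (blockSize b) (ℕ.+-comm n 1)) (members↔ (block b))

  ∈∉⇒≢ : ∀ {P Q b} → P ∈ block b → Q ∉ block b → P ≢ Q
  ∈∉⇒≢ p q∉ refl = q∉ p

  block-unique : ∀ {P Q d d'} → P ≢ Q → P ∈ block d → Q ∈ block d →
                 P ∈ block d' → Q ∈ block d' → d ≡ d'
  block-unique {P} {Q} P≢Q p q p' q' with twoPoints P Q P≢Q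
  ... | _ , _ , unique = trans (unique _ p q) (sym (unique _ p' q'))

  transport : ∀ {P d d'} → d ≡ d' → P ∈ block d → P ∈ block d'
  transport {P} = subst (λ d → P ∈ block d)

  join : (P Q : Point U) → P ≢ Q → Block U
  join P Q P≢Q = proj₁ (twoPoints P Q P≢Q)

  join∋ˡ : ∀ P Q (P≢Q : P ≢ Q) → P ∈ block (join P Q P≢Q)
  join∋ˡ P Q P≢Q = proj₁ (proj₁ (proj₂ (twoPoints P Q P≢Q)))

  join∋ʳ : ∀ P Q (P≢Q : P ≢ Q) → Q ∈ block (join P Q P≢Q)
  join∋ʳ P Q P≢Q = proj₂ (proj₁ (proj₂ (twoPoints P Q P≢Q)))

  index : ∀ {P b} → P ∈ block b → Fin (suc n)
  index {P} {b} P∈b = Inverse.to (points↔ b) (P , P∈b)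

  index-injective : ∀ {P Q b} (P∈b : P ∈ block b) (Q∈b : Q ∈ block b) →
                    index P∈b ≡ index Q∈b → P ≡ Q
  index-injective {b = b} _ _ eq = cong proj₁ (Injection.injective (↔⇒↣ (points↔ b)) eq)

  pointAt : Block U → Fin (suc n) → Point U
  pointAt b i = proj₁ (Inverse.from (points↔ b) i)

  pointAt∈ : ∀ b i → pointAt b i ∈ block b
  pointAt∈ b i = proj₂ (Inverse.from (points↔ b) i)

  index-pointAt : ∀ {P b} (P∈b : P ∈ block b) i → P ≡ pointAt b i → index P∈b ≡ i
  index-pointAt {b = b} P∈b i refl =
    trans (cong (Inverse.to (points↔ b)) (member-≡ refl)) (Inverse.strictlyInverseˡ (points↔ b) i)

  module _ {P : Point U} {b : Block U} (P∈b : P ∈ block b) where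

    pointExcept : Fin n → Point U
    pointExcept j = pointAt b (punchIn (index P∈b) j)

    pointExcept∈ : ∀ j → pointExcept j ∈ block b
    pointExcept∈ j = pointAt∈ b _

    pointExcept≢ : ∀ j → pointExcept j ≢ P
    pointExcept≢ j eq = punchInᵢ≢i (index P∈b) j (sym (index-pointAt P∈b _ (sym eq)))

    pointExcept-injective : Injective _≡_ _≡_ pointExcept
    pointExcept-injective {j} {j'} eq = punchIn-injective (index P∈b) j j'
      (trans (sym (index-pointAt (pointExcept∈ j) _ refl)) (index-pointAt (pointExcept∈ j) _ eq))

  injective-into-block⇒≤ : ∀ {A : Set} {a b} → A ↔ Fin a → (f : A → Point U) →
    (∀ x → f x ∈ block b) → Injective _≡_ _≡_ f → a ≤ suc n
  injective-into-block⇒≤ {b = b} A↔ f f∈b f-injective =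
    injective⇒card≤ A↔ (points↔ b) {λ x → f x , f∈b x} (f-injective ∘ cong proj₁)

  Collinear : Point U → Point U → Point U → Set
  Collinear P Q Z = ∃[ d ] P ∈ block d × Q ∈ block d × Z ∈ block d

  projection-injective : ∀ {P Q Q' Z s s'} → P ∉ block s → P ∉ block s' →
    Q ∈ block s → Q' ∈ block s → Z ∈ block s' →
    Collinear P Q Z → Collinear P Q' Z → Q ≡ Q'
  projection-injective {P} {Q} {Q'} {s = s} P∉s P∉s' Q∈s Q'∈s Z∈s'
    (d , P∈d , Q∈d , Z∈d) (d' , P∈d' , Q'∈d' , Z∈d') with Q ≟ Q'
  ... | yes Q≡Q' = Q≡Q'
  ... | no  Q≢Q' = contradiction (transport d≡s P∈d) P∉s
    where
      d'≡d : d' ≡ d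
      d'≡d = block-unique (∈∉⇒≢ Z∈s' P∉s' ∘ sym) P∈d' Z∈d' P∈d Z∈d
      d≡s : d ≡ s
      d≡s = block-unique Q≢Q' Q∈d (transport d'≡d Q'∈d') Q∈s Q'∈s

  perspectivity : ∀ {P s s'} → P ∉ block s → P ∉ block s' →
    (∀ {Q} → Q ∈ block s → ∃[ Z ] Z ∈ block s' × Collinear P Q Z) →
    ∀ {Z} → Z ∈ block s' → ∃[ Q ] Q ∈ block s × Collinear P Q Z
  perspectivity {P} {s} {s'} P∉s P∉s' project {Z} Z∈s' =
    preimage (injective⇒onto (points↔ s) (points↔ s') image-injective ℕ.≤-refl (Z , Z∈s'))
    where
      image : Members (block s) → Members (block s')
      image (Q , Q∈s) = proj₁ (project Q∈s) , proj₁ (proj₂ (project Q∈s))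

      image-injective : Injective _≡_ _≡_ image
      image-injective {Q , Q∈s} {Q' , Q'∈s} eq = member-≡
        (projection-injective P∉s P∉s' Q∈s Q'∈s (proj₁ (proj₂ (project Q∈s)))
          (proj₂ (proj₂ (project Q∈s)))
          (subst (Collinear P Q') (sym (cong proj₁ eq)) (proj₂ (proj₂ (project Q'∈s)))))

      preimage : ∃ (λ x → image x ≡ (Z , Z∈s')) → ∃[ Q ] Q ∈ block s × Collinear P Q Z
      preimage ((Q , Q∈s) , image≡Z) =
        Q , Q∈s , subst (Collinear P Q) (cong proj₁ image≡Z) (proj₂ (proj₂ (project Q∈s)))

  collinear-swap : ∀ {P Q Z} → Collinear P Q Z → Collinear Q P Z
  collinear-swap (d , P∈d , Q∈d , Z∈d) = d , Q∈d , P∈d , Z∈d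


module FullPoints {m : ℕ} (U : Unital (suc m)) (b₁ b₂ : Block U) where
  open Geometry U

  FullBlock : Block U → Set
  FullBlock = BlockInFullPoints U b₁ b₂

  Transversal : Block U → Set
  Transversal d = Meets U d b₁ × Meets U d b₂

  module _ {P : Point U} (P-full : IsFullPoint U b₁ b₂ P) where
    private
      P∉b₁ : P ∉ block b₁
      P∉b₁ = proj₁ P-full
      P∉b₂ : P ∉ block b₂
      P∉b₂ = proj₁ (proj₂ P-full)
      joins : ∀ Q → Q ∈ block b₁ → JoinMeets U P Q b₂
      joins = proj₂ (proj₂ P-full)

    full⇒collinear-b₂ : ∀ {Q} → Q ∈ block b₁ → ∃[ Y ] Y ∈ block b₂ × Collinear P Q Y
    full⇒collinear-b₂ {Q} Q∈b₁ = collinear (joins Q Q∈b₁ d P∈d Q∈d)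
      where
        P≢Q : P ≢ Q
        P≢Q = ∈∉⇒≢ Q∈b₁ P∉b₁ ∘ sym
        d : Block U
        d = join P Q P≢Q
        P∈d : P ∈ block d
        P∈d = join∋ˡ P Q P≢Q
        Q∈d : Q ∈ block d
        Q∈d = join∋ʳ P Q P≢Q
        collinear : Meets U d b₂ → ∃[ Y ] Y ∈ block b₂ × Collinear P Q Y
        collinear (Y , Y∈d , Y∈b₂) = Y , Y∈b₂ , d , P∈d , Q∈d , Y∈d

    full⇒transversal₁ : ∀ {Q d} → Q ∈ block b₁ → P ∈ block d → Q ∈ block d → Transversal d
    full⇒transversal₁ {Q} {d} Q∈b₁ P∈d Q∈d = (Q , Q∈d , Q∈b₁) , joins Q Q∈b₁ d P∈d Q∈d

    full⇒transversal₂ : ∀ {Y d} → Y ∈ block b₂ → P ∈ block d → Y ∈ block d → Transversal d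
    full⇒transversal₂ {Y} {d} Y∈b₂ P∈d Y∈d =
      viaB₁ (perspectivity P∉b₁ P∉b₂ full⇒collinear-b₂ Y∈b₂)
      where
        viaB₁ : ∃[ Q ] Q ∈ block b₁ × Collinear P Q Y → Transversal d
        viaB₁ (Q , Q∈b₁ , d' , P∈d' , Q∈d' , Y∈d') =
          full⇒transversal₁ Q∈b₁ P∈d (transport (block-unique P≢Y P∈d' Y∈d' P∈d Y∈d) Q∈d')
          where
            P≢Y : P ≢ Y
            P≢Y = ∈∉⇒≢ Y∈b₂ P∉b₂ ∘ sym

  fullBlock⇒collinear-b₂ : ∀ {c Q} → FullBlock c → Q ∈ block b₁ →
                           ∀ {P} → P ∈ block c → ∃[ Z ] Z ∈ block b₂ × Collinear Q P Z
  fullBlock⇒collinear-b₂ c-full Q∈b₁ P∈c with full⇒collinear-b₂ (c-full _ P∈c) Q∈b₁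
  ... | Z , Z∈b₂ , P,Q,Z = Z , Z∈b₂ , collinear-swap P,Q,Z

  full-∉₁ : ∀ {c P} → FullBlock c → P ∈ block c → P ∉ block b₁
  full-∉₁ c-full P∈c = proj₁ (c-full _ P∈c)

  full-∉₂ : ∀ {c P} → FullBlock c → P ∈ block c → P ∉ block b₂
  full-∉₂ c-full P∈c = proj₁ (proj₂ (c-full _ P∈c))

  disjoint₁₂ : ∀ {c} → FullBlock c → b₁ ≢ b₂ → Disjoint U b₁ b₂
  disjoint₁₂ {c} c-full b₁≢b₂ X X∈b₁ X∈b₂ =
    noCommonPoint (perspectivity Q∉c Q∉b₂ (fullBlock⇒collinear-b₂ c-full Q∈b₁) X∈b₂)
    where
      Q : Point U
      Q = pointExcept X∈b₁ zero
      Q∈b₁ : Q ∈ block b₁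
      Q∈b₁ = pointExcept∈ X∈b₁ zero
      Q≢X : Q ≢ X
      Q≢X = pointExcept≢ X∈b₁ zero
      Q∉c : Q ∉ block c
      Q∉c Q∈c = full-∉₁ c-full Q∈c Q∈b₁
      Q∉b₂ : Q ∉ block b₂
      Q∉b₂ Q∈b₂ = b₁≢b₂ (block-unique Q≢X Q∈b₁ X∈b₁ Q∈b₂ X∈b₂)
      noCommonPoint : ∃[ P ] P ∈ block c × Collinear Q P X → ⊥
      noCommonPoint (P , P∈c , d , Q∈d , P∈d , X∈d) =
        full-∉₁ c-full P∈c (transport (block-unique Q≢X Q∈d X∈d Q∈b₁ X∈b₁) P∈d)

  module _ (b₁b₂-disjoint : Disjoint U b₁ b₂) where

    transversal-meets-full : ∀ {c d} → FullBlock c → Transversal d → Meets U d c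
    transversal-meets-full {c} {d} c-full ((Q , Q∈d , Q∈b₁) , (Y , Y∈d , Y∈b₂)) =
      meet (perspectivity Q∉c (b₁b₂-disjoint Q Q∈b₁) (fullBlock⇒collinear-b₂ c-full Q∈b₁) Y∈b₂)
      where
        Q∉c : Q ∉ block c
        Q∉c Q∈c = full-∉₁ c-full Q∈c Q∈b₁
        Q≢Y : Q ≢ Y
        Q≢Y refl = b₁b₂-disjoint Q Q∈b₁ Y∈b₂
        meet : ∃[ P ] P ∈ block c × Collinear Q P Y → Meets U d c
        meet (P , P∈c , d' , Q∈d' , P∈d' , Y∈d') =
          P , transport (block-unique Q≢Y Q∈d' Y∈d' Q∈d Y∈d) P∈d' , P∈c

    full⇒collinear-fullBlock : ∀ {P c Q} → IsFullPoint U b₁ b₂ P → FullBlock c → Q ∈ block b₁ →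
                               ∃[ Z ] Z ∈ block c × Collinear P Q Z
    full⇒collinear-fullBlock {P} {c} {Q} P-full c-full Q∈b₁ = via (full⇒collinear-b₂ P-full Q∈b₁)
      where
        via : ∃[ Y ] Y ∈ block b₂ × Collinear P Q Y → ∃[ Z ] Z ∈ block c × Collinear P Q Z
        via (Y , Y∈b₂ , d , P∈d , Q∈d , Y∈d) =
          Product.map₂ (λ (Z∈d , Z∈c) → Z∈c , d , P∈d , Q∈d , Z∈d)
            (transversal-meets-full c-full ((Q , Q∈d , Q∈b₁) , (Y , Y∈d , Y∈b₂)))

    fullBlocks-disjoint : ∀ {c c'} → FullBlock c → FullBlock c' → c ≢ c' → Disjoint U c c'
    fullBlocks-disjoint {c} {c'} c-full c'-full c≢c' R R∈c R∈c' =
      noCommonPoint (perspectivity (full-∉₁ c-full X∈c) X∉c'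
                       (full⇒collinear-fullBlock (c-full X X∈c) c'-full) R∈c')
      where
        X : Point U
        X = pointExcept R∈c zero
        X∈c : X ∈ block c
        X∈c = pointExcept∈ R∈c zero
        X≢R : X ≢ R
        X≢R = pointExcept≢ R∈c zero
        X∉c' : X ∉ block c'
        X∉c' X∈c' = c≢c' (block-unique X≢R X∈c R∈c X∈c' R∈c')
        noCommonPoint : ∃[ Q ] Q ∈ block b₁ × Collinear X Q R → ⊥
        noCommonPoint (Q , Q∈b₁ , d , X∈d , Q∈d , R∈d) =
          full-∉₁ c-full (transport (block-unique X≢R X∈d R∈d X∈c R∈c) Q∈d) Q∈b₁

    fullBlocks-transversal : ∀ {c c' P Z d} → FullBlock c → FullBlock c' → c ≢ c' →
      P ∈ block c → Z ∈ block c' → P ∈ block d → Z ∈ block d → Transversal d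
    fullBlocks-transversal {c} {c'} {P} {Z} {d} c-full c'-full c≢c' P∈c Z∈c' P∈d Z∈d =
      via (perspectivity (full-∉₁ c-full P∈c) P∉c' (full⇒collinear-fullBlock P-full c'-full) Z∈c')
      where
        P-full : IsFullPoint U b₁ b₂ P
        P-full = c-full P P∈c
        P∉c' : P ∉ block c'
        P∉c' = fullBlocks-disjoint c-full c'-full c≢c' P P∈c
        P≢Z : P ≢ Z
        P≢Z refl = P∉c' Z∈c' 
        via : ∃[ Q ] Q ∈ block b₁ × Collinear P Q Z → Transversal d
        via (Q , Q∈b₁ , d' , P∈d' , Q∈d' , Z∈d') =
          full⇒transversal₁ P-full Q∈b₁ P∈d (transport (block-unique P≢Z P∈d' Z∈d' P∈d Z∈d) Q∈d')

  module _ {t : ℕ} (cs : Fin t → Block U) (cs-injective : Injective _≡_ _≡_ cs)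
           (cs-full : ∀ i → FullBlock (cs i)) (b₁b₂-disjoint : Disjoint U b₁ b₂) where

    bs : Fin (2 + t) → Block U
    bs zero          = b₁
    bs (suc zero)    = b₂
    bs (suc (suc i)) = cs i

    cs-distinct : ∀ {i j : Fin t} → _≢_ {A = Fin (2 + t)} (suc (suc i)) (suc (suc j)) → cs i ≢ cs j
    cs-distinct i≢j eq = i≢j (cong (λ k → suc (suc k)) (cs-injective eq))

    bs-disjoint : ∀ i j → i ≢ j → Disjoint U (bs i) (bs j)
    bs-disjoint zero          zero          i≢j = contradiction refl i≢j
    bs-disjoint zero          (suc zero)    _   = b₁b₂-disjoint
    bs-disjoint zero          (suc (suc j)) _   R R∈b₁ R∈c = full-∉₁ (cs-full j) R∈c R∈b₁
    bs-disjoint (suc zero)    zero          _   R R∈b₂ R∈b₁ = b₁b₂-disjoint R R∈b₁ R∈b₂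
    bs-disjoint (suc zero)    (suc zero)    i≢j = contradiction refl i≢j
    bs-disjoint (suc zero)    (suc (suc j)) _   R R∈b₂ R∈c = full-∉₂ (cs-full j) R∈c R∈b₂
    bs-disjoint (suc (suc i)) zero          _   R R∈c = full-∉₁ (cs-full i) R∈c
    bs-disjoint (suc (suc i)) (suc zero)    _   R R∈c = full-∉₂ (cs-full i) R∈c
    bs-disjoint (suc (suc i)) (suc (suc j)) i≢j =
      fullBlocks-disjoint b₁b₂-disjoint (cs-full i) (cs-full j) (cs-distinct i≢j)

    bs-transversal : ∀ i j → i ≢ j → ∀ {P Q d} → P ∈ block (bs i) → Q ∈ block (bs j) →
                     P ∈ block d → Q ∈ block d → Transversal d
    bs-transversal zero          zero          i≢j _ _ _ _ = contradiction refl i≢j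
    bs-transversal zero          (suc zero)    _ {P} {Q} P∈b₁ Q∈b₂ P∈d Q∈d =
      (P , P∈d , P∈b₁) , (Q , Q∈d , Q∈b₂)
    bs-transversal zero          (suc (suc j)) _ P∈b₁ Q∈c P∈d Q∈d =
      full⇒transversal₁ (cs-full j _ Q∈c) P∈b₁ Q∈d P∈d
    bs-transversal (suc zero)    zero          _ {P} {Q} P∈b₂ Q∈b₁ P∈d Q∈d =
      (Q , Q∈d , Q∈b₁) , (P , P∈d , P∈b₂)
    bs-transversal (suc zero)    (suc zero)    i≢j _ _ _ _ = contradiction refl i≢j
    bs-transversal (suc zero)    (suc (suc j)) _ P∈b₂ Q∈c P∈d Q∈d =
      full⇒transversal₂ (cs-full j _ Q∈c) P∈b₂ Q∈d P∈d
    bs-transversal (suc (suc i)) zero          _ P∈c Q∈b₁ P∈d Q∈d =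
      full⇒transversal₁ (cs-full i _ P∈c) Q∈b₁ P∈d Q∈d
    bs-transversal (suc (suc i)) (suc zero)    _ P∈c Q∈b₂ P∈d Q∈d =
      full⇒transversal₂ (cs-full i _ P∈c) Q∈b₂ P∈d Q∈d
    bs-transversal (suc (suc i)) (suc (suc j)) i≢j P∈c Q∈c' P∈d Q∈d =
      fullBlocks-transversal b₁b₂-disjoint (cs-full i) (cs-full j) (cs-distinct i≢j) P∈c Q∈c' P∈d Q∈d

    transversal-meets-bs : ∀ {d} → Transversal d → ∀ l → Meets U d (bs l)
    transversal-meets-bs (meets₁ , _)      zero          = meets₁
    transversal-meets-bs (_      , meets₂) (suc zero)    = meets₂
    transversal-meets-bs transversal       (suc (suc l)) =
      transversal-meets-full b₁b₂-disjoint (cs-full l) transversal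

    fullBlocks-dualNet : 1 ≤ t → IsEmbeddedDualNet U (2 + t) bs
    fullBlocks-dualNet (s≤s _) = s≤s (s≤s (s≤s z≤n)) , λ i j i≢j →
      bs-disjoint i j i≢j ,
      λ P Q P∈bᵢ Q∈bⱼ l d P∈d Q∈d → transversal-meets-bs (bs-transversal i j i≢j P∈bᵢ Q∈bⱼ P∈d Q∈d) l

cube+2≰cube+1 : ∀ n → n * (n * n) + 2 ≰ n ^ 3 + 1
cube+2≰cube+1 n le = contradiction (ℕ.+-cancelˡ-≤ (n * (n * n)) 2 1 le′) λ { (s≤s ()) }
  where
    le′ : n * (n * n) + 2 ≤ n * (n * n) + 1
    le′ = subst (λ k → n * (n * n) + 2 ≤ n * (n * k) + 1) (ℕ.*-identityʳ n) le

points×2≰labels : ∀ m → let n = 3 + m in (n ^ 3 + 1) * 2 ≰ n * (suc n * 2) + suc n * suc n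
points×2≰labels m le =
  ℕ.<-irrefl refl (ℕ.≤-trans (ℕ.≤-trans (ℕ.m≤m+n _ _) (ℕ.≤-reflexive (sym (expand m)))) le)
  where
    -- (3 + x) ^ 3 is written out as a product for the solver.
    expand : ∀ x → ((3 + x) * ((3 + x) * ((3 + x) * 1)) + 1) * 2 ≡
      suc ((3 + x) * ((4 + x) * 2) + (4 + x) * (4 + x) + (2 * x * x * x + 15 * x * x + 32 * x + 15))
    expand = solve-∀

module DualNetOfOrderSize {m : ℕ} (U : Unital (3 + m)) (bs : Fin (3 + m) → Block U)
                          (net : IsEmbeddedDualNet U (3 + m) bs) where
  open Geometry U

  bs-disjoint : ∀ {i j} → i ≢ j → Disjoint U (bs i) (bs j)
  bs-disjoint i≢j = proj₁ (proj₂ net _ _ i≢j)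

  bs-index-unique : ∀ {R i j} → R ∈ block (bs i) → R ∈ block (bs j) → i ≡ j
  bs-index-unique {R} {i} {j} R∈bᵢ R∈bⱼ with i ≟ j
  ... | yes i≡j = i≡j
  ... | no  i≢j = contradiction R∈bⱼ (bs-disjoint i≢j R R∈bᵢ)

  NetLine : Block U → Set
  NetLine d = ∀ l → Meets U d (bs l)

  meet : ∀ {d} → NetLine d → Fin (3 + m) → Point U
  meet d-net l = proj₁ (d-net l)

  meet∈ : ∀ {d} (d-net : NetLine d) l → meet d-net l ∈ block d
  meet∈ d-net l = proj₁ (proj₂ (d-net l))

  meet∈bs : ∀ {d} (d-net : NetLine d) l → meet d-net l ∈ block (bs l)
  meet∈bs d-net l = proj₂ (proj₂ (d-net l))

  netLine-through : ∀ {i j P Q d} → i ≢ j → P ∈ block (bs i) → Q ∈ block (bs j) →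
                    P ∈ block d → Q ∈ block d → NetLine d
  netLine-through i≢j P∈bᵢ Q∈bⱼ P∈d Q∈d l = proj₂ (proj₂ net _ _ i≢j) _ _ P∈bᵢ Q∈bⱼ l _ P∈d Q∈d

  netLine≢bs : ∀ {d} → NetLine d → ∀ l → d ≢ bs l
  netLine≢bs d-net zero    refl =
    bs-disjoint (λ ()) _ (meet∈bs d-net (suc zero)) (meet∈ d-net (suc zero))
  netLine≢bs d-net (suc l) refl = bs-disjoint (λ ()) _ (meet∈bs d-net zero) (meet∈ d-net zero)

  netLine-meets-once : ∀ {d l R R'} → NetLine d → R ∈ block (bs l) → R' ∈ block (bs l) →
                       R ∈ block d → R' ∈ block d → R ≡ R'
  netLine-meets-once {d} {l} {R} {R'} d-net R∈bₗ R'∈bₗ R∈d R'∈d with R ≟ R'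
  ... | yes R≡R' = R≡R'
  ... | no  R≢R' = contradiction (block-unique R≢R' R∈d R'∈d R∈bₗ R'∈bₗ) (netLine≢bs d-net l)

  Outside : Point U → Set
  Outside P = ∀ l → P ∉ block (bs l)

  outside≢ : ∀ {P R l} → Outside P → R ∈ block (bs l) → P ≢ R
  outside≢ P-out R∈bₗ refl = P-out _ R∈bₗ

  outsider-unique : ∀ {d P P'} → NetLine d → Outside P → Outside P' →
                    P ∈ block d → P' ∈ block d → P ≡ P'
  outsider-unique {d} {P} {P'} d-net P-out P'-out P∈d P'∈d with P ≟ P'
  ... | yes P≡P' = P≡P'
  ... | no  P≢P' =
    contradiction (injective-into-block⇒≤ (↔-sym +↔⊎) f f∈d f-injective) (ℕ.1+n≰n ∘ s≤s⁻¹)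
    where
      f : Fin 2 ⊎ Fin (3 + m) → Point U
      f (inj₁ zero)       = P
      f (inj₁ (suc zero)) = P'
      f (inj₂ l)          = meet d-net l

      f∈d : ∀ x → f x ∈ block d
      f∈d (inj₁ zero)       = P∈d
      f∈d (inj₁ (suc zero)) = P'∈d
      f∈d (inj₂ l)          = meet∈ d-net l

      f-injective : Injective _≡_ _≡_ f
      f-injective {inj₁ zero}       {inj₁ zero}       _  = refl
      f-injective {inj₁ zero}       {inj₁ (suc zero)} eq = contradiction eq P≢P'
      f-injective {inj₁ (suc zero)} {inj₁ zero}       eq = contradiction (sym eq) P≢P'
      f-injective {inj₁ (suc zero)} {inj₁ (suc zero)} _  = refl
      f-injective {inj₁ zero}       {inj₂ l}          eq = ⊥-elim (outside≢ P-out (meet∈bs d-net l) eq)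
      f-injective {inj₁ (suc zero)} {inj₂ l}          eq = ⊥-elim (outside≢ P'-out (meet∈bs d-net l) eq)
      f-injective {inj₂ l}          {inj₁ zero}       eq =
        ⊥-elim (outside≢ P-out (meet∈bs d-net l) (sym eq))
      f-injective {inj₂ l}          {inj₁ (suc zero)} eq =
        ⊥-elim (outside≢ P'-out (meet∈bs d-net l) (sym eq))
      f-injective {inj₂ l}          {inj₂ l'}         eq =
        cong inj₂ (bs-index-unique (meet∈bs d-net l)
                     (subst (_∈ block (bs l')) (sym eq) (meet∈bs d-net l')))

  module _ {P : Point U} (P-out : Outside P)
           (X : Fin (3 + m) → Point U) (X∈ : ∀ l → X l ∈ block (bs l))
           (X-only : ∀ {l d R} → NetLine d → P ∈ block d → R ∈ block (bs l) → R ∈ block d → R ≡ X l)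
           where
    private
      R : Fin (3 + m) → Fin (3 + m) → Point U
      R l = pointExcept (X∈ l)

      R∈ : ∀ l a → R l a ∈ block (bs l)
      R∈ l = pointExcept∈ (X∈ l)

      P≢R : ∀ l a → P ≢ R l a
      P≢R l a = outside≢ P-out (R∈ l a)

      L : Fin (3 + m) → Fin (3 + m) → Block U
      L l a = join P (R l a) (P≢R l a)

      P∈L : ∀ l a → P ∈ block (L l a)
      P∈L l a = join∋ˡ P (R l a) (P≢R l a)

      R∈L : ∀ l a → R l a ∈ block (L l a)
      R∈L l a = join∋ʳ P (R l a) (P≢R l a)

      g : Fin (3 + m) → Fin (3 + m) → Fin (3 + m) → Point U
      g l a = pointExcept (P∈L l a)

      g∈L : ∀ l a j → g l a j ∈ block (L l a)
      g∈L l a = pointExcept∈ (P∈L l a)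

      L-meets-once : ∀ {l a l' Y} → Y ∈ block (bs l') → Y ∈ block (L l a) → Y ≡ R l a
      L-meets-once {l} {a} {l'} {Y} Y∈bₗ' Y∈L = decide (Y ≟ R l a) (l' ≟ l)
        where
          decide : Dec (Y ≡ R l a) → Dec (l' ≡ l) → Y ≡ R l a
          decide (yes Y≡R) _        = Y≡R
          decide (no  Y≢R) (yes l'≡l) =
            ⊥-elim (P-out l (transport (block-unique Y≢R Y∈L (R∈L l a) Y∈bₗ (R∈ l a)) (P∈L l a)))
            where
              Y∈bₗ : Y ∈ block (bs l)
              Y∈bₗ = subst (λ k → Y ∈ block (bs k)) l'≡l Y∈bₗ'
          decide (no  Y≢R) (no  l'≢l) =
            ⊥-elim (pointExcept≢ (X∈ l) a
              (X-only (netLine-through l'≢l Y∈bₗ' (R∈ l a) Y∈L (R∈L l a)) (P∈L l a) (R∈ l a) (R∈L l a)))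

      R-injective : ∀ {l a l' a'} → R l a ≡ R l' a' → (l , a) ≡ (l' , a')
      R-injective {l} {a} {l'} {a'} eq =
        sameBlock (bs-index-unique (R∈ l a) (subst (_∈ block (bs l')) (sym eq) (R∈ l' a'))) eq
        where
          sameBlock : ∀ {l l' a a'} → l ≡ l' → R l a ≡ R l' a' → (l , a) ≡ (l' , a')
          sameBlock refl eq = cong (_ ,_) (pointExcept-injective (X∈ _) eq)

      g-injective : ∀ {l a j l' a' j'} → g l a j ≡ g l' a' j' → (l , a , j) ≡ (l' , a' , j')
      g-injective {l} {a} {j} {l'} {a'} {j'} eq = sameLine (R-injective (sym R'≡R)) eq
        where
          L≡L' : L l a ≡ L l' a'
          L≡L' = block-unique (pointExcept≢ (P∈L l a) j ∘ sym) (P∈L l a) (g∈L l a j)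
                   (P∈L l' a') (subst (_∈ block (L l' a')) (sym eq) (g∈L l' a' j'))
          R'≡R : R l' a' ≡ R l a
          R'≡R = L-meets-once (R∈ l' a') (transport (sym L≡L') (R∈L l' a'))
          sameLine : ∀ {l a j l' a' j'} → (l , a) ≡ (l' , a') → g l a j ≡ g l' a' j' →
                     (l , a , j) ≡ (l' , a' , j')
          sameLine refl eq = cong (λ j → _ , _ , j) (pointExcept-injective (P∈L _ _) eq)

      X₀∉L : ∀ l a → X zero ∉ block (L l a)
      X₀∉L l a X₀∈L =
        X₀≢R (bs-index-unique (X∈ zero) (subst (_∈ block (bs l)) (sym X₀≡R) (R∈ l a))) X₀≡R
        where
          X₀≡R : X zero ≡ R l a
          X₀≡R = L-meets-once (X∈ zero) X₀∈L
          X₀≢R : ∀ {l a} → zero ≡ l → X zero ≢ R l a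
          X₀≢R refl eq = pointExcept≢ (X∈ zero) _ (sym eq)

      f : (Fin (3 + m) × Fin (3 + m) × Fin (3 + m)) ⊎ Fin 2 → Point U
      f (inj₁ (l , a , j)) = g l a j
      f (inj₂ zero)        = P
      f (inj₂ (suc zero))  = X zero

      f-injective : Injective _≡_ _≡_ f
      f-injective {inj₁ _}           {inj₁ _}           eq = cong inj₁ (g-injective eq)
      f-injective {inj₁ (l , a , j)} {inj₂ zero}        eq = ⊥-elim (pointExcept≢ (P∈L l a) j eq)
      f-injective {inj₁ (l , a , j)} {inj₂ (suc zero)}  eq =
        ⊥-elim (X₀∉L l a (subst (_∈ block (L l a)) eq (g∈L l a j)))
      f-injective {inj₂ zero}        {inj₁ (l , a , j)} eq = ⊥-elim (pointExcept≢ (P∈L l a) j (sym eq))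
      f-injective {inj₂ (suc zero)}  {inj₁ (l , a , j)} eq =
        ⊥-elim (X₀∉L l a (subst (_∈ block (L l a)) (sym eq) (g∈L l a j)))
      f-injective {inj₂ zero}        {inj₂ zero}        _  = refl
      f-injective {inj₂ zero}        {inj₂ (suc zero)}  eq = ⊥-elim (outside≢ P-out (X∈ zero) eq)
      f-injective {inj₂ (suc zero)}  {inj₂ zero}        eq = ⊥-elim (outside≢ P-out (X∈ zero) (sym eq))
      f-injective {inj₂ (suc zero)}  {inj₂ (suc zero)}  _  = refl

    outsider-pencil-overflow : ⊥
    outsider-pencil-overflow =
      cube+2≰cube+1 (3 + m) (injective⇒card≤ source↔ ↔-refl f-injective)
      where
        source↔ : ((Fin (3 + m) × Fin (3 + m) × Fin (3 + m)) ⊎ Fin 2) ↔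
                  Fin ((3 + m) * ((3 + m) * (3 + m)) + 2)
        source↔ = ↔-trans (↔-trans (↔-refl ×-↔ ↔-sym *↔×) (↔-sym *↔×) ⊎-↔ ↔-refl) (↔-sym +↔⊎)

  TwoNetLinesThrough : Point U → Set
  TwoNetLinesThrough P =
    Σ (Fin 2 → Block U) λ ds → Injective _≡_ _≡_ ds × (∀ i → NetLine (ds i) × P ∈ block (ds i))

  meets? : ∀ d c → Dec (Meets U d c)
  meets? d c = any? (λ R → R ∈? block d ×-dec R ∈? block c)

  netLine? : ∀ d → Dec (NetLine d)
  netLine? d = all? (λ l → meets? d (bs l))

  twoNetLinesThrough : ∀ {P d d'} → d ≢ d' → NetLine d → NetLine d' →
                       P ∈ block d → P ∈ block d' → TwoNetLinesThrough P
  twoNetLinesThrough {P} {d} {d'} d≢d' d-net d'-net P∈d P∈d' = ds , ds-injective , through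
    where
      ds : Fin 2 → Block U
      ds zero       = d
      ds (suc zero) = d'
      ds-injective : Injective _≡_ _≡_ ds
      ds-injective {zero}       {zero}       _  = refl
      ds-injective {zero}       {suc zero}   eq = contradiction eq d≢d'
      ds-injective {suc zero}   {zero}       eq = contradiction (sym eq) d≢d'
      ds-injective {suc zero}   {suc zero}   _  = refl
      through : ∀ i → NetLine (ds i) × P ∈ block (ds i)
      through zero       = d-net , P∈d
      through (suc zero) = d'-net , P∈d'

  outsider-on-two-netLines : ∀ {P} → Outside P → TwoNetLinesThrough P
  outsider-on-two-netLines {P} P-out = fromFirst (any? (λ d → netLine? d ×-dec P ∈? block d))
    where
      fromFirst : Dec (∃ λ d → NetLine d × P ∈ block d) → TwoNetLinesThrough P
      fromFirst (no none) =
        ⊥-elim (outsider-pencil-overflow P-out (λ l → pointAt (bs l) zero) (λ l → pointAt∈ (bs l) zero)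
                  (λ d-net P∈d _ _ → ⊥-elim (none (_ , d-net , P∈d))))
      fromFirst (yes (ℓ , ℓ-net , P∈ℓ)) =
        fromSecond (any? (λ d → ¬? (d ≟ ℓ) ×-dec netLine? d ×-dec P ∈? block d))
        where
          fromSecond : Dec (∃ λ d → d ≢ ℓ × NetLine d × P ∈ block d) → TwoNetLinesThrough P
          fromSecond (yes (d , d≢ℓ , d-net , P∈d)) = twoNetLinesThrough d≢ℓ d-net ℓ-net P∈d P∈ℓ
          fromSecond (no  ¬other) =
            ⊥-elim (outsider-pencil-overflow P-out (meet ℓ-net) (meet∈bs ℓ-net) onlyMeet)
            where
              onlyMeet : ∀ {l d R} → NetLine d → P ∈ block d → R ∈ block (bs l) → R ∈ block d →
                         R ≡ meet ℓ-net l
              onlyMeet {l} {d} d-net P∈d R∈bₗ R∈d =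
                netLine-meets-once ℓ-net R∈bₗ (meet∈bs ℓ-net l) (transport d≡ℓ R∈d) (meet∈ ℓ-net l)
                where
                  d≡ℓ : d ≡ ℓ
                  d≡ℓ = decidable-stable (d ≟ ℓ) (λ d≢ℓ → ¬other (d , d≢ℓ , d-net , P∈d))

  lineLabel : ∀ {d} → NetLine d → Fin (4 + m) × Fin (4 + m)
  lineLabel d-net = index (meet∈bs d-net zero) , index (meet∈bs d-net (suc zero))

  lineLabel-injective : ∀ {d d'} (d-net : NetLine d) (d'-net : NetLine d') →
                        lineLabel d-net ≡ lineLabel d'-net → d ≡ d'
  lineLabel-injective {d} {d'} d-net d'-net eq =
    block-unique R₀≢R₁ (meet∈ d-net zero) (meet∈ d-net (suc zero))
      (subst (_∈ block d') (sym R₀≡R₀') (meet∈ d'-net zero))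
      (subst (_∈ block d') (sym R₁≡R₁') (meet∈ d'-net (suc zero)))
    where
      R₀≡R₀' : meet d-net zero ≡ meet d'-net zero
      R₀≡R₀' = index-injective _ _ (,-injectiveˡ eq)
      R₁≡R₁' : meet d-net (suc zero) ≡ meet d'-net (suc zero)
      R₁≡R₁' = index-injective _ _ (,-injectiveʳ eq)
      R₀≢R₁ : meet d-net zero ≢ meet d-net (suc zero)
      R₀≢R₁ eq = bs-disjoint (λ ()) _ (meet∈bs d-net zero)
                   (subst (_∈ block (bs (suc zero))) (sym eq) (meet∈bs d-net (suc zero)))

  Class : Point U → Set
  Class P = (∃ λ l → P ∈ block (bs l)) ⊎ (Outside P × TwoNetLinesThrough P)

  classify : ∀ P → Class P
  classify P = fromDec (any? (λ l → P ∈? block (bs l)))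
    where
      fromDec : Dec (∃ λ l → P ∈ block (bs l)) → Class P
      fromDec (yes inBlock)  = inj₁ inBlock
      fromDec (no  ¬inBlock) = inj₂ (P-out , outsider-on-two-netLines P-out)
        where
          P-out : Outside P
          P-out l P∈bₗ = ¬inBlock (l , P∈bₗ)

  Label : Set
  Label = (Fin (3 + m) × Fin (4 + m) × Fin 2) ⊎ (Fin (4 + m) × Fin (4 + m))

  labelBy : ∀ {P} → Class P → Fin 2 → Label
  labelBy (inj₁ (l , P∈bₗ))            i = inj₁ (l , index P∈bₗ , i)
  labelBy (inj₂ (_ , _ , _ , through)) i = inj₂ (lineLabel (proj₁ (through i)))

  labelBy-injectiveᴾ : ∀ {P P'} (c : Class P) (c' : Class P') i i' →
                       labelBy c i ≡ labelBy c' i' → P ≡ P'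
  labelBy-injectiveᴾ (inj₁ (l , P∈bₗ)) (inj₁ (l' , P'∈bₗ')) _ _ eq =
    sameBlock (,-injectiveˡ (inj₁-injective eq)) P∈bₗ P'∈bₗ'
      (,-injectiveˡ (,-injectiveʳ (inj₁-injective eq)))
    where
      sameBlock : ∀ {l l' P P'} → l ≡ l' → (P∈bₗ : P ∈ block (bs l)) (P'∈bₗ' : P' ∈ block (bs l')) →
                  index P∈bₗ ≡ index P'∈bₗ' → P ≡ P'
      sameBlock refl = index-injective
  labelBy-injectiveᴾ (inj₂ (P-out , ds , _ , through)) (inj₂ (P'-out , ds' , _ , through')) i i' eq =
    outsider-unique (proj₁ (through i)) P-out P'-out (proj₂ (through i)) (transport d'≡d (proj₂ (through' i')))
    where
      d'≡d : ds' i' ≡ ds i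
      d'≡d = sym (lineLabel-injective (proj₁ (through i)) (proj₁ (through' i')) (inj₂-injective eq))

  labelBy-injectiveⁱ : ∀ {P} (c : Class P) {i i'} → labelBy c i ≡ labelBy c i' → i ≡ i'
  labelBy-injectiveⁱ (inj₁ _) eq = ,-injectiveʳ (,-injectiveʳ (inj₁-injective eq))
  labelBy-injectiveⁱ (inj₂ (_ , _ , ds-injective , through)) eq =
    ds-injective (lineLabel-injective (proj₁ (through _)) (proj₁ (through _)) (inj₂-injective eq))

  label : Point U × Fin 2 → Label
  label (P , i) = labelBy (classify P) i

  label-injective : Injective _≡_ _≡_ label
  label-injective {P , i} {P' , i'} eq =
    samePoint (labelBy-injectiveᴾ (classify P) (classify P') i i' eq) eq
    where
      samePoint : ∀ {P'} → P ≡ P' → labelBy (classify P) i ≡ labelBy (classify P') i' →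
                  (P , i) ≡ (P' , i')
      samePoint refl eq = cong (P ,_) (labelBy-injectiveⁱ (classify P) eq)

  impossible : ⊥
  impossible = points×2≰labels m (injective⇒card≤ (↔-sym *↔×) label↔ label-injective)
    where
      label↔ : Label ↔ Fin ((3 + m) * ((4 + m) * 2) + (4 + m) * (4 + m))
      label↔ = ↔-trans (↔-trans (↔-refl ×-↔ ↔-sym *↔×) (↔-sym *↔×) ⊎-↔ ↔-sym *↔×) (↔-sym +↔⊎)

dualNet-restrict : ∀ {n k k'} {U : Unital n} {bs : Fin k → Block U} (k'≤k : k' ≤ k) → 3 ≤ k' →
                   IsEmbeddedDualNet U k bs → IsEmbeddedDualNet U k' (λ i → bs (inject≤ i k'≤k))
dualNet-restrict k'≤k 3≤k' (_ , net) = 3≤k' , λ i j i≢j →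
  let (disjoint , joinsMeet) = net _ _ (i≢j ∘ inject≤-injective k'≤k k'≤k i j)
  in  disjoint , λ P Q P∈bᵢ Q∈bⱼ l → joinsMeet P Q P∈bᵢ Q∈bⱼ (inject≤ l k'≤k)

dualNet-bound : ∀ {m} (U : Unital (3 + m)) k (bs : Fin k → Block U) →
                IsEmbeddedDualNet U k bs → k ≤ 2 + m
dualNet-bound {m} U k bs net with k ≤? 2 + m
... | yes k≤2+m = k≤2+m
... | no  k≰2+m =
  ⊥-elim (DualNetOfOrderSize.impossible U _ (dualNet-restrict {U = U} 3+m≤k (s≤s (s≤s (s≤s z≤n))) net))
  where
    3+m≤k : 3 + m ≤ k
    3+m≤k = ℕ.≰⇒> k≰2+m

fullBlocks-bound : ∀ {m} (U : Unital (3 + m)) (b₁ b₂ : Block U) → b₁ ≢ b₂ →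
                   ∀ t (cs : Fin t → Block U) → Injective _≡_ _≡_ cs → (∀ i → BlockInFullPoints U b₁ b₂ (cs i)) → t ≤ m
fullBlocks-bound U b₁ b₂ b₁≢b₂ zero    cs cs-injective cs-full = z≤n
fullBlocks-bound U b₁ b₂ b₁≢b₂ (suc t) cs cs-injective cs-full =
  s≤s⁻¹ (s≤s⁻¹ (dualNet-bound U _ _ (fullBlocks-dualNet cs cs-injective cs-full b₁b₂-disjoint (s≤s z≤n))))
  where
    open FullPoints U b₁ b₂
    b₁b₂-disjoint : Disjoint U b₁ b₂
    b₁b₂-disjoint = disjoint₁₂ (cs-full zero) b₁≢b₂

proposition2p6 : (n : ℕ) → 3 ≤ n → (U : Unital n) →
    ((k : ℕ) → (bs : Fin k → Block U) → IsEmbeddedDualNet U k bs → k ≤ n ∸ 1)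
    × ((b₁ b₂ : Block U) → b₁ ≢ b₂ → (t : ℕ) → (cs : Fin t → Block U) →
       Injective _≡_ _≡_ cs → (∀ i → BlockInFullPoints U b₁ b₂ (cs i)) → t ≤ n ∸ 3)
proposition2p6 (suc (suc (suc m))) (s≤s (s≤s (s≤s _))) U = dualNet-bound U , fullBlocks-bound U
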